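{- Let $n\ge1$, $\sigma\in S_{2n}$ and $D\in\mathcal{D}_n$. If $D^\sigma$ is (the circular representation of) some Dyck path $P\in\mathcal{D}_n$, i.e. $\tau_{D^\sigma}=\tau_P$, then $P=\lambda(D)$ where $\lambda=\sigma^{ -1}$.
   Context: A Dyck path of size $n$ is a word $P=P_1\cdots P_{2n}$ in the letters $\mathtt{u},\mathtt{d}$ with $n$ of each letter such that every prefix has at least as many $\mathtt{u}$'s as $\mathtt{d}$'s; $\mathcal{D}_n$ is the set of them. The tunneling $\tau_D\in S_{2n}$ of $D\in\mathcal{D}_n$ is the fixed-point-free involution pairing each up-step position with the position of its matching down-step. For $\sigma\in S_{2n}$ write $\sigma_k=\sigma(k)$, $\sigma_{[k]}=\{\sigma_1,\dots,\sigma_k\}$. The $\sigma$-path $\sigma(D)$ is the word of length $2n$ with $\sigma(D)_k=\mathtt{u}$ if $\tau_D(\sigma_k)\notin\sigma_{[k]}$ and $\mathtt{d}$ otherwise. The permuted circular representation $D^\sigma$ is the pairing of $[2n]$ (placed as labels $\sigma_1,\dots,\sigma_{2n}$ clockwise on a circle) in which $\sigma_k$ and $\sigma_\ell$ are joined whenever $\tau_D(k)=\ell$; its tunneling is the involution $\tau_{D^\sigma}$ with $\tau_{D^\sigma}(\sigma(k))=\sigma(\tau_D(k))$ for all $k$, i.e. $\tau_{D^\sigma}=\sigma\tau_D\sigma^{ -1}$. We say $D^\sigma$ is a path $P$ if $\tau_{D^\sigma}=\tau_P$ for some $P\in\mathcal{D}_n$. -}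

module Defs where

open import Data.Nat using (ℕ; zero; suc; _+_; _*_; _≤_)
open import Data.Fin using (Fin; toℕ; _≟_)
open import Data.Fin.Permutation using (Permutation′; _⟨$⟩ʳ_)
open import Data.List using (List; []; _∷_; take; tabulate; allFin)
open import Data.List.Relation.Unary.Any using (any?)
open import Data.Product using (_×_; _,_)
open import Relation.Nullary using (does)
open import Relation.Binary.PropositionalEquality using (_≡_)
open import Data.Bool using (if_then_else_)

data Step : Set where
  u d : Step

-- A word of length m, positions indexed 0 .. m-1 (position k here is position k+1 in the paper).
Word : ℕ → Set
Word m = Fin m → Step

toList : ∀ {m} → Word m → List Step
toList = tabulate

countU : List Step → ℕ
countU []       = 0
countU (u ∷ xs) = suc (countU xs)
countU (d ∷ xs) = countU xs

countD : List Step → ℕ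
countD []       = 0
countD (u ∷ xs) = countD xs
countD (d ∷ xs) = suc (countD xs)

IsDyck : (n : ℕ) → Word (2 * n) → Set
IsDyck n w =
  (countU (toList w) ≡ n) × (countD (toList w) ≡ n) ×
  (∀ k → countD (take k (toList w)) ≤ countU (take k (toList w)))

-- Matching of each up-step with its matching down-step, via the usual
-- stack scan (push the position of a u; a d pops and is matched with the
-- most recent unmatched u).
matchGo : ∀ {m} → Word m → List (Fin m) → List (Fin m) → List (Fin m × Fin m)
matchGo w []       st = []
matchGo w (i ∷ is) st with w i
... | u = matchGo w is (i ∷ st)
matchGo w (i ∷ is) []       | d = matchGo w is []
matchGo w (i ∷ is) (j ∷ st) | d = (j , i) ∷ matchGo w is st

matching : ∀ {m} → Word m → List (Fin m × Fin m)
matching {m} w = matchGo w (allFin m) []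

partner : ∀ {m} → List (Fin m × Fin m) → Fin m → Fin m
partner []             i = i
partner ((a , b) ∷ ps) i =
  if does (a ≟ i) then b else (if does (b ≟ i) then a else partner ps i)

-- The tunneling τ_D (a fixed-point-free involution when D is a Dyck path).
tunnel : ∀ {m} → Word m → Fin m → Fin m
tunnel w = partner (matching w)

-- The σ-path σ(D): σ(D)_k = u if τ_D(σ_k) ∉ σ_[k], d otherwise.
sigmaPath : ∀ {m} → Permutation′ m → Word m → Word m
sigmaPath σ w k =
  if does (any? (λ j → (σ ⟨$⟩ʳ j) ≟ tunnel w (σ ⟨$⟩ʳ k)) (take (suc (toℕ k)) (allFin _)))
  then d else u

-- A position k of a Dyck path P is a down-step exactly when its tunnel partner lies at or
-- before it: τ_P(k) ≤ k.  By definition, λ(D)_k is a down-step exactly when the position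
-- λ⁻¹(τ_D(λ_k)) lies at or before k, and for λ = σ⁻¹ the hypothesis τ_P = σ τ_D σ⁻¹ says
-- that this position is τ_P(k).  So P and λ(D) agree letter by letter; only P needs to
-- be a Dyck path.
module Submission where

open import Defs
open import Data.Nat using (ℕ; suc; _*_; _≤_; _+_; s≤s; s≤s⁻¹; z≤n)
open import Data.Nat.Properties using (≤-refl; <⇒≤; <⇒≱; +-suc; +-identityʳ; suc-injective)
open import Data.Fin as F using (Fin; toℕ; _≟_; _≤?_)
open import Data.Fin.Permutation using (Permutation′; _⟨$⟩ʳ_; _⟨$⟩ˡ_; flip; inverseˡ; inverseʳ)
open import Data.List using (List; []; _∷_; take; tabulate; allFin; map; length)
open import Data.List.Properties using (map-tabulate)
open import Data.List.Relation.Unary.All as All using (All; []; _∷_)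
open import Data.List.Relation.Unary.AllPairs using (AllPairs; []; _∷_)
open import Data.List.Relation.Unary.AllPairs.Properties using (tabulate⁺-<)
open import Data.List.Relation.Unary.Any using (Any; here; there; any?)
open import Data.List.Membership.Propositional using (_∈_; find; lose)
open import Data.List.Membership.Propositional.Properties using (∈-allFin)
open import Data.Product using (_×_; _,_; proj₁; proj₂; Σ-syntax)
open import Data.Empty using (⊥-elim)
open import Data.Bool using (Bool; if_then_else_)
open import Function.Bundles using (_⇔_; mk⇔)
open import Relation.Nullary using (¬_; does; yes; no)
open import Relation.Nullary.Decidable using (dec-true; dec-false; does-⇔)
open import Relation.Binary.PropositionalEquality using (_≡_; refl; sym; trans; cong; subst; module ≡-Reasoning)

downIf : Bool → Step
downIf b = if b then d else u

u≢d : ¬ u ≡ d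
u≢d ()

MatchedPair : ∀ {m} → Word m → Fin m × Fin m → Set
MatchedPair w (a , b) = w a ≡ u × w b ≡ d × a F.< b

Opens : ∀ {m} → List (Fin m × Fin m) → Fin m → Set
Opens ps x = Any (λ p → proj₁ p ≡ x) ps

partner-≤-of-d : ∀ {m} {w : Word m} {ps} → All (MatchedPair w) ps →
  ∀ {k} → w k ≡ d → partner ps k F.≤ k
partner-≤-of-d [] wk = ≤-refl
partner-≤-of-d {ps = (a , b) ∷ ps} ((wa , wb , a<b) ∷ matched) {k} wk with a ≟ k | b ≟ k
... | yes refl | _        = ⊥-elim (u≢d (trans (sym wa) wk))
... | no _     | yes refl = <⇒≤ a<b
... | no _     | no _     = partner-≤-of-d matched wk

partner->-of-u : ∀ {m} {w : Word m} {ps} → All (MatchedPair w) ps →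
  ∀ {k} → w k ≡ u → Opens ps k → k F.< partner ps k
partner->-of-u {ps = (a , b) ∷ ps} ((wa , wb , a<b) ∷ matched) {k} wk opens with a ≟ k | b ≟ k | opens
... | yes refl | _        | _           = a<b
... | no _     | yes refl | _           = ⊥-elim (u≢d (trans (sym wk) wb))
... | no a≢k   | no _     | here a≡k    = ⊥-elim (a≢k a≡k)
... | no _     | no _     | there opens′ = partner->-of-u matched wk opens′

matchGo-matched : ∀ {m} (w : Word m) is st → AllPairs F._<_ is →
  All (λ j → w j ≡ u) st → All (λ j → All (j F.<_) is) st →
  All (MatchedPair w) (matchGo w is st)
matchGo-matched w []       st       _               _          _ = []
matchGo-matched w (i ∷ is) st       (i<is ∷ sorted) ups below with w i in wi
... | u = matchGo-matched w is (i ∷ st) sorted (wi ∷ ups) (i<is ∷ All.map All.tail below)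
matchGo-matched w (i ∷ is) []       (_ ∷ sorted) [] [] | d = matchGo-matched w is [] sorted [] []
matchGo-matched w (i ∷ is) (j ∷ st) (_ ∷ sorted) (wj ∷ ups) ((j<i ∷ _) ∷ below) | d =
  (wj , wi , j<i) ∷ matchGo-matched w is st sorted ups (All.map All.tail below)

matching-matched : ∀ {m} (w : Word m) → All (MatchedPair w) (matching w)
matching-matched {m} w = matchGo-matched w (allFin m) [] (tabulate⁺-< (λ i<j → i<j)) [] []

-- A step sequence that, started at height e, never goes below height 0 and ends at height 0.
Closes : ℕ → List Step → Set
Closes e xs = countD xs ≡ countU xs + e × (∀ k → countD (take k xs) ≤ countU (take k xs) + e)

closes-u : ∀ {e xs} → Closes e (u ∷ xs) → Closes (suc e) xs
closes-u {xs = xs} (total , prefix) =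
  trans total (sym (+-suc _ _)) ,
  λ k → subst (countD (take k xs) ≤_) (sym (+-suc _ _)) (prefix (suc k))

closes-d : ∀ {e xs} → Closes (suc e) (d ∷ xs) → Closes e xs
closes-d {xs = xs} (total , prefix) =
  suc-injective (trans total (+-suc _ _)) ,
  λ k → s≤s⁻¹ (subst (suc (countD (take k xs)) ≤_) (+-suc _ _) (prefix (suc k)))

¬closes-d : ∀ {xs} → ¬ Closes 0 (d ∷ xs)
¬closes-d (_ , prefix) with prefix 1
... | ()

dyck-closes : ∀ {n} {w : Word (2 * n)} → IsDyck n w → Closes 0 (toList w)
dyck-closes {w = w} (#u , #d , prefix) =
  trans #d (trans (sym #u) (sym (+-identityʳ _))) ,
  λ k → subst (countD (take k (toList w)) ≤_) (sym (+-identityʳ _)) (prefix k)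

matchGo-covers : ∀ {m} (w : Word m) is st → Closes (length st) (map w is) →
  (∀ {x} → x ∈ st → Opens (matchGo w is st) x) ×
  (∀ {x} → x ∈ is → w x ≡ u → Opens (matchGo w is st) x)
matchGo-covers w []       []      _        = (λ ()) , (λ ())
matchGo-covers w []       (_ ∷ _) (() , _)
matchGo-covers w (i ∷ is) st      closes with w i in wi
... | u =
  let opensSt , opensIs = matchGo-covers w is (i ∷ st) (closes-u closes)
  in  (λ x∈ → opensSt (there x∈)) ,
      λ { (here refl) _ → opensSt (here refl) ; (there x∈) wx → opensIs x∈ wx }
matchGo-covers w (i ∷ is) []       closes | d = ⊥-elim (¬closes-d closes)
matchGo-covers w (i ∷ is) (j ∷ st) closes | d =
  let opensSt , opensIs = matchGo-covers w is st (closes-d closes)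
  in  (λ { (here refl) → here refl ; (there x∈) → there (opensSt x∈) }) ,
      λ { (here refl) wx → ⊥-elim (u≢d (trans (sym wx) wi)) ; (there x∈) wx → there (opensIs x∈ wx) }

tunnel->-of-u : ∀ {n} {w : Word (2 * n)} → IsDyck n w → ∀ {k} → w k ≡ u → k F.< tunnel w k
tunnel->-of-u {n} {w} dyck {k} wk =
  partner->-of-u (matching-matched w) wk (proj₂ (matchGo-covers w (allFin _) [] closes) (∈-allFin k) wk)
  where
  closes : Closes 0 (map w (allFin (2 * n)))
  closes = subst (Closes 0) (sym (map-tabulate (λ i → i) w)) (dyck-closes dyck)

step-by-tunnel : ∀ {n} {w : Word (2 * n)} → IsDyck n w → ∀ k → w k ≡ downIf (does (tunnel w k ≤? k))
step-by-tunnel {w = w} dyck k with w k in wk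
... | d = sym (cong downIf (dec-true (_ ≤? k) (partner-≤-of-d (matching-matched w) wk)))
... | u = sym (cong downIf (dec-false (_ ≤? k) (<⇒≱ (tunnel->-of-u dyck wk))))

∈-take-tabulate⁺ : ∀ {n} {X : Set} (f : Fin n → X) {j k : Fin n} → j F.≤ k →
  f j ∈ take (suc (toℕ k)) (tabulate f)
∈-take-tabulate⁺ {suc n} f {F.zero}  {k}       j≤k       = here refl
∈-take-tabulate⁺ {suc n} f {F.suc j} {F.suc k} (s≤s j≤k) =
  there (∈-take-tabulate⁺ (λ i → f (F.suc i)) j≤k)

∈-take-tabulate⁻ : ∀ {n} {X : Set} (f : Fin n → X) (k : Fin n) {x : X} →
  x ∈ take (suc (toℕ k)) (tabulate f) → Σ[ j ∈ Fin n ] j F.≤ k × f j ≡ x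
∈-take-tabulate⁻ {suc n} f k         (here x≡f0) = F.zero , z≤n , sym x≡f0
∈-take-tabulate⁻ {suc n} f (F.suc k) (there x∈)  =
  let j , j≤k , fj≡x = ∈-take-tabulate⁻ (λ i → f (F.suc i)) k x∈
  in  F.suc j , s≤s j≤k , fj≡x

hit-in-prefix⇔ : ∀ {m} (π : Permutation′ m) (x k : Fin m) →
  Any (λ j → π ⟨$⟩ʳ j ≡ x) (take (suc (toℕ k)) (allFin m)) ⇔ π ⟨$⟩ˡ x F.≤ k
hit-in-prefix⇔ {m} π x k = mk⇔ to from
  where
  to : Any (λ j → π ⟨$⟩ʳ j ≡ x) (take (suc (toℕ k)) (allFin m)) → π ⟨$⟩ˡ x F.≤ k
  to hit with find hit
  ... | j , j∈ , refl with ∈-take-tabulate⁻ (λ i → i) k j∈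
  ...   | .j , j≤k , refl = subst (F._≤ k) (sym (inverseˡ π)) j≤k
  from : π ⟨$⟩ˡ x F.≤ k → Any (λ j → π ⟨$⟩ʳ j ≡ x) (take (suc (toℕ k)) (allFin m))
  from λx≤k = lose (∈-take-tabulate⁺ (λ i → i) λx≤k) (inverseʳ π)

sigmaPath-by-tunnel : ∀ {m} (π : Permutation′ m) (w : Word m) (k : Fin m) →
  sigmaPath π w k ≡ downIf (does (π ⟨$⟩ˡ tunnel w (π ⟨$⟩ʳ k) ≤? k))
sigmaPath-by-tunnel π w k = cong downIf (does-⇔ (hit-in-prefix⇔ π _ k) (any? _ _) (_ ≤? k))

theorem2 : (n : ℕ) → 1 ≤ n → (σ : Permutation′ (2 * n)) → (D P : Word (2 * n)) →
    IsDyck n D → IsDyck n P →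
    (∀ i → tunnel P i ≡ σ ⟨$⟩ʳ (tunnel D (σ ⟨$⟩ˡ i))) →
    ∀ k → P k ≡ sigmaPath (flip σ) D k
theorem2 n _ σ D P _ dyckP τP≡στDσ⁻¹ k = begin
  P k
    ≡⟨ step-by-tunnel dyckP k ⟩
  downIf (does (tunnel P k ≤? k))
    ≡⟨ cong (λ i → downIf (does (i ≤? k))) (τP≡στDσ⁻¹ k) ⟩
  downIf (does (σ ⟨$⟩ʳ tunnel D (σ ⟨$⟩ˡ k) ≤? k))
    ≡⟨ sigmaPath-by-tunnel (flip σ) D k ⟨
  sigmaPath (flip σ) D k
    ∎
  where open ≡-Reasoning
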